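{- Let $v\in V(G)$ with $|N(v)|\ge k^{t-1}(2t-1)$. Consider sequences $v_1,\ldots,v_s$ with sets $B_1,\ldots,B_s$ built as follows: $v_1=v$, $B_1=N(v)$, and, given $v_1,\ldots,v_i$ and $B_1,\ldots,B_i$, $v_{i+1}$ is any vertex not in $\{v_1,\ldots,v_i\}$ with $|N[v_{i+1}]\cap B_i|\ge k^{t-i-1}(2t-i)$, and $B_{i+1}=N(v_{i+1})\cap B_i$. Let $v_1,\ldots,v_s$ be a maximal such sequence (one that cannot be extended). Then $s<t$ and $D'\cap\{v_1,\ldots,v_s\}\neq\emptyset$.
   Context: Graphs are finite, simple, undirected. $N(v)$ is the open and $N[v]=N(v)\cup\{v\}$ the closed neighborhood; for a set $Z$, $N[Z]=\bigcup_{z\in Z}N[z]$; $Z$ dominates $W$ if $W\subseteq N[Z]$. $\nabla_1(G)$ is the maximum of $|E(H)|/|V(H)|$ over all $1$-shallow minors $H$ of $G$ (graphs obtained from pairwise vertex-disjoint connected subgraphs of $G$ of radius at most $1$ as branch sets, two vertices adjacent when some edge of $G$ joins their branch sets). Standing assumptions: $G$ is a fixed graph such that for every $v\in V(G)$, $N(v)$ can be dominated by at most $2\nabla_1(G)$ vertices different from $v$. Set $k=2\nabla_1(G)$; $t$ is the least integer such that $G$ contains no $K_{t,t}$ as a subgraph. $D$ is a fixed minimum dominating set of $G$ (a minimum-size set with $N[D]=V(G)$). $\hat D$ is the set of all vertices $v$ such that $N(v)$ cannot be dominated by at most $2\nabla_1(G)$ vertices of $D$ different from $v$, and $D'=D\cup\hat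 D$. -}

module Defs where

open import Data.Nat as ℕ using (ℕ; zero; suc; _<ᵇ_)
open import Data.Integer as ℤ using (ℤ; +_; -[1+_])
open import Data.Rational as ℚ using (ℚ; 0ℚ; 1ℚ; _*_; _/_; 1/_; ≢-nonZero)
open import Data.Rational.Properties using (_≟_)
open import Data.Bool using (Bool; true; false; _∧_; if_then_else_)
open import Data.Fin using (Fin; toℕ)
open import Data.Fin.Subset using (Subset; _∈_; _∉_; _∩_; _∪_; ⁅_⁆; ∣_∣)
open import Data.Vec using (tabulate; lookup)
open import Data.List using (List; []; _∷_; map; allFin; length)
open import Data.Bool.ListAction using (any)
open import Data.Nat.ListAction using (sum)
import Data.List.Membership.Propositional as L
open import Data.Product using (Σ; ∃; _×_; _,_)
open import Data.Sum using (_⊎_)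
open import Relation.Nullary using (¬_; yes; no)
open import Relation.Binary.PropositionalEquality using (_≡_; _≢_)

_^_ : ℚ → ℕ → ℚ
q ^ zero  = 1ℚ
q ^ suc m = q * (q ^ m)

-- integer exponent; for negative exponents q^(-m) = (1/q)^m.
-- Convention 0^(-m) = 0 (never relevant).
_^ℤ_ : ℚ → ℤ → ℚ
q ^ℤ (+ m) = q ^ m
q ^ℤ -[1+ m ] with q ≟ 0ℚ
... | yes _   = 0ℚ
... | no q≢0 = (1/_ q {{≢-nonZero q≢0}}) ^ suc m

⟦_⟧ : ℕ → ℚ
⟦ m ⟧ = (+ m) / 1

record Graph : Set where
  field
    n      : ℕ
    adj    : Fin n → Fin n → Bool
    sym    : ∀ u v → adj u v ≡ adj v u
    irrefl : ∀ v → adj v v ≡ false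

module _ (G : Graph) where
  open Graph G

  V : Set
  V = Fin n

  Adj : V → V → Set
  Adj u v = adj u v ≡ true

  N : V → Subset n
  N v = tabulate (adj v)

  N[_] : V → Subset n
  N[ v ] = ⁅ v ⁆ ∪ N v

  Dominates : Subset n → Subset n → Set
  Dominates Z W = ∀ w → w ∈ W → ∃ λ z → z ∈ Z × w ∈ N[ z ]

  linked : Subset n → Subset n → Bool
  linked X Y = any (λ x → lookup X x ∧ any (λ y → lookup Y y ∧ adj x y) (allFin n)) (allFin n)

  record ShallowMinor (m : ℕ) : Set where
    field
      branch   : Fin m → Subset n
      centre   : Fin m → V
      -- each branch set induces a connected subgraph of radius ≤ 1:
      -- it contains a centre adjacent to all its other vertices
      centre∈  : ∀ i → centre i ∈ branch i
      radius1  : ∀ i x → x ∈ branch i → x ∈ N[ centre i ]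
      disjoint : ∀ i j x → i ≢ j → x ∈ branch i → x ∉ branch j

    edges : ℕ
    edges = sum (map (λ i → sum (map (λ j →
              if (toℕ i <ᵇ toℕ j) ∧ linked (branch i) (branch j) then 1 else 0)
              (allFin m))) (allFin m))

  open ShallowMinor public

  IsNabla1 : ℚ → Set
  IsNabla1 r =
    (∀ m (H : ShallowMinor (suc m)) → (+ edges H) / suc m ℚ.≤ r) ×
    (∃ λ m → Σ (ShallowMinor (suc m)) λ H → (+ edges H) / suc m ≡ r)

  HasKtt : ℕ → Set
  HasKtt t = Σ (Subset n) λ A → Σ (Subset n) λ B →
    ∣ A ∣ ≡ t × ∣ B ∣ ≡ t × (∀ x → x ∈ A → x ∉ B) ×
    (∀ a b → a ∈ A → b ∈ B → Adj a b)

  IsLeastNoKtt : ℕ → Set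
  IsLeastNoKtt t = ¬ HasKtt t × (∀ t' → t' ℕ.< t → HasKtt t')

  IsDominatingSet : Subset n → Set
  IsDominatingSet D = ∀ w → ∃ λ z → z ∈ D × w ∈ N[ z ]

  IsMinimumDominatingSet : Subset n → Set
  IsMinimumDominatingSet D =
    IsDominatingSet D × (∀ D₁ → IsDominatingSet D₁ → ∣ D ∣ ℕ.≤ ∣ D₁ ∣)

  NbhDominatedBy : ℚ → Subset n → V → Set
  NbhDominatedBy k S v = Σ (Subset n) λ Z →
    (∀ z → z ∈ Z → z ∈ S) × v ∉ Z × ⟦ ∣ Z ∣ ⟧ ℚ.≤ k × Dominates Z (N v)

  StandingAssumption : ℚ → Set
  StandingAssumption k = ∀ v → NbhDominatedBy k Data.Fin.Subset.⊤ v

  _∈D̂[_,_] : V → ℚ → Subset n → Set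
  v ∈D̂[ k , D ] = ¬ NbhDominatedBy k D v

  _∈D'[_,_] : V → ℚ → Subset n → Set
  v ∈D'[ k , D ] = v ∈ D ⊎ v ∈D̂[ k , D ]

  -- the sequences v₁,…,v_s with sets B₁,…,B_s.
  -- A sequence is stored as a list in REVERSE order: v_i ∷ … ∷ v₁ ∷ [].

  B : List V → Subset n
  B []           = Data.Fin.Subset.⊥
  B (u ∷ [])     = N u
  B (u ∷ w ∷ us) = N u ∩ B (w ∷ us)

  threshold : ℚ → ℕ → ℕ → ℚ
  threshold k t i = (k ^ℤ ((+ t) ℤ.- (+ i) ℤ.- (+ 1))) * (((+ (2 ℕ.* t)) ℤ.- (+ i)) / 1)

  CanExtend : ℚ → ℕ → List V → V → Set
  CanExtend k t us w =
    ¬ (w L.∈ us) × threshold k t (length us) ℚ.≤ ⟦ ∣ N[ w ] ∩ B us ∣ ⟧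

  data ValidSeq (k : ℚ) (t : ℕ) (v : V) : List V → Set where
    start : ValidSeq k t v (v ∷ [])
    step  : ∀ {us w} → ValidSeq k t v us → CanExtend k t us w → ValidSeq k t v (w ∷ us)

  Maximal : ℚ → ℕ → List V → Set
  Maximal k t us = ¬ (∃ λ w → CanExtend k t us w)

  degreeBound : ℚ → ℕ → ℚ
  degreeBound k t = (k ^ℤ ((+ t) ℤ.- (+ 1))) * (((+ (2 ℕ.* t)) ℤ.- (+ 1)) / 1)

{-# OPTIONS --safe #-}
module Submission where

open import Defs
open import Data.Bool using (true; false; T; if_then_else_)
open import Data.Bool.Properties using (T-≡; T-∧)
open import Data.Empty using (⊥-elim)
open import Data.Fin using (Fin; zero; suc)
open import Data.Fin.Subset using (Subset; ∣_∣; _∈_; _∉_; _⊆_; _∩_; _∪_; ⁅_⁆; ⋃; ⊥; Nonempty)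
open import Data.Fin.Subset.Properties
  using (∉⊥; ⊥⊆; ∣⊥∣≡0; ∣⁅x⁆∣≡1; ∣p∣≤∣x∷p∣; x∈⁅x⁆; x∈⁅y⁆⇒x≡y; x∈p∩q⁺; x∈p∩q⁻; x∈p∪q⁺; x∈p∪q⁻;
         p⊆p∪q; q⊆p∪q; p∩q⊆p; p∩q⊆q; p⊆q⇒∣p∣≤∣q∣; ∪-identityˡ; _∈?_)
import Data.Integer as ℤ
import Data.Integer.Properties as ℤP
open import Data.List using (List; []; _∷_; length; map)
open import Data.List.Membership.Propositional using (lose) renaming (_∈_ to _∈ₗ_)
open import Data.List.Membership.Propositional.Properties using (∈-map⁺; ∈-map⁻; ∈-allFin)
import Data.List.Properties as List
open import Data.List.Relation.Unary.Any as Any using (Any; here; there; any?)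
open import Data.List.Relation.Unary.Any.Properties using (any⁺)
open import Data.Nat as ℕ using (ℕ; zero; suc; _+_; _∸_; _<_; z≤n; s≤s)
open import Data.Nat.ListAction using (sum)
open import Data.Nat.Properties
  using (≤-refl; ≤-reflexive; ≤-trans; <⇒≤; ≰⇒>; ≤∧≢⇒<; +-mono-≤; +-monoʳ-≤; *-monoʳ-≤; +-suc; +-comm;
         +-identityʳ; ∸-+-assoc; m≤n*m; m<n⇒0<n∸m; n∸n≡0; m+n∸m≡n; module ≤-Reasoning)
import Data.Nat.Coprimality as Coprime
open import Data.Product using (∃; ∃₂; _×_; _,_; proj₁)
open import Data.Rational as ℚ using (ℚ; mkℚ; 1ℚ; -_; _≤_; _*_; Positive; NonNegative)
import Data.Rational.Properties as ℚP
open import Data.Rational.Unnormalised as ℚᵘ using (*≡*)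
import Data.Rational.Unnormalised.Properties as ℚᵘP
open import Data.Sum using (inj₁; inj₂)
open import Data.Vec using ([]; _∷_; here; there; lookup)
import Data.Vec.Properties as Vec
open import Function using (_∘_)
open import Function.Bundles using (Equivalence)
open import Relation.Binary.PropositionalEquality
  using (_≡_; _≢_; refl; sym; trans; cong; cong₂; subst; subst₂; module ≡-Reasoning)
open import Relation.Nullary using (¬_; Dec; yes; no)

open Equivalence using (to; from)

-- Write Bᵢ for the common neighbourhood of v₁, …, vᵢ. Along any sequence
-- |Bᵢ| ≥ k^(t-i) (2t-i): the closed neighbourhood of v_{i+1} meets Bᵢ in at least
-- k^(t-i-1) (2t-i) vertices, and passing to the open neighbourhood loses at most
-- v_{i+1} itself, which costs nothing because k ≥ 1 (a single edge is a 1-shallow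
-- minor of density 1/2). A sequence of length t would give a K_{t,t} between
-- {v₁, …, v_t} and t vertices of B_t, so s < t. If no vᵢ is in D and some Z ⊆ D
-- with |Z| ≤ k dominated N(vᵢ) ⊇ B_s, then some z ∈ Z would have
-- |N[z] ∩ B_s| ≥ |B_s| / k ≥ k^(t-s-1) (2t-s) and would extend the sequence;
-- so every vᵢ, in particular v₁, is in D̂.

⟦⟧≡mkℚ : ∀ m → ⟦ m ⟧ ≡ mkℚ (ℤ.+ m) 0 (Coprime.sym (Coprime.1-coprimeTo m))
⟦⟧≡mkℚ m = ℚP.normalize-coprime (Coprime.sym (Coprime.1-coprimeTo m))

⟦⟧-mono-≤ : ∀ {m n} → m ℕ.≤ n → ⟦ m ⟧ ≤ ⟦ n ⟧
⟦⟧-mono-≤ {m} {n} m≤n rewrite ⟦⟧≡mkℚ m | ⟦⟧≡mkℚ n =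
  ℚ.*≤* (ℤP.*-monoʳ-≤-nonNeg (ℤ.+ 1) (ℤ.+≤+ m≤n))

⟦⟧-cancel-≤ : ∀ {m n} → ⟦ m ⟧ ≤ ⟦ n ⟧ → m ℕ.≤ n
⟦⟧-cancel-≤ {m} {n} ⟦m⟧≤⟦n⟧ rewrite ⟦⟧≡mkℚ m | ⟦⟧≡mkℚ n with ⟦m⟧≤⟦n⟧
... | ℚ.*≤* m*1≤n*1 = ℤP.drop‿+≤+ (ℤP.*-cancelʳ-≤-pos (ℤ.+ m) (ℤ.+ n) (ℤ.+ 1) m*1≤n*1)

⟦⟧-homo-+ : ∀ m n → ⟦ m + n ⟧ ≡ ⟦ m ⟧ ℚ.+ ⟦ n ⟧
⟦⟧-homo-+ m n = ℚP.toℚᵘ-injective (ℚᵘP.≃-trans homo (ℚᵘP.≃-sym (ℚP.toℚᵘ-homo-+ ⟦ m ⟧ ⟦ n ⟧)))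
  where
  homo : ℚ.toℚᵘ ⟦ m + n ⟧ ℚᵘ.≃ ℚ.toℚᵘ ⟦ m ⟧ ℚᵘ.+ ℚ.toℚᵘ ⟦ n ⟧
  homo rewrite ⟦⟧≡mkℚ m | ⟦⟧≡mkℚ n | ⟦⟧≡mkℚ (m + n) =
    *≡* (cong (ℤ._* ℤ.+ 1) (sym (cong₂ ℤ._+_ (ℤP.*-identityʳ (ℤ.+ m)) (ℤP.*-identityʳ (ℤ.+ n)))))

⟦⟧-homo-* : ∀ m n → ⟦ m ℕ.* n ⟧ ≡ ⟦ m ⟧ * ⟦ n ⟧
⟦⟧-homo-* m n = ℚP.toℚᵘ-injective (ℚᵘP.≃-trans homo (ℚᵘP.≃-sym (ℚP.toℚᵘ-homo-* ⟦ m ⟧ ⟦ n ⟧)))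
  where
  homo : ℚ.toℚᵘ ⟦ m ℕ.* n ⟧ ℚᵘ.≃ ℚ.toℚᵘ ⟦ m ⟧ ℚᵘ.* ℚ.toℚᵘ ⟦ n ⟧
  homo rewrite ⟦⟧≡mkℚ m | ⟦⟧≡mkℚ n | ⟦⟧≡mkℚ (m ℕ.* n) = *≡* (cong (ℤ._* ℤ.+ 1) (ℤP.pos-* m n))

⟦⟧-nonNeg : ∀ m → NonNegative ⟦ m ⟧
⟦⟧-nonNeg m = ℚ.nonNegative (⟦⟧-mono-≤ {0} {m} z≤n)

1≤p⇒nonNeg : ∀ {p} → 1ℚ ≤ p → NonNegative p
1≤p⇒nonNeg 1≤p = ℚ.nonNegative (ℚP.≤-trans (⟦⟧-mono-≤ {0} {1} z≤n) 1≤p)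

1≤p⇒pos : ∀ {p} → 1ℚ ≤ p → Positive p
1≤p⇒pos 1≤p = ℚ.positive (ℚP.<-≤-trans (ℚ.*<* (ℤ.+<+ (s≤s z≤n))) 1≤p)

1≤p⇒q≤p*q : ∀ {p} → 1ℚ ≤ p → ∀ q → .{{NonNegative q}} → q ≤ p * q
1≤p⇒q≤p*q {p} 1≤p q = subst (_≤ p * q) (ℚP.*-identityˡ q) (ℚP.*-monoʳ-≤-nonNeg q 1≤p)

1≤p⇒1≤p^n : ∀ {p} → 1ℚ ≤ p → ∀ n → 1ℚ ≤ p ^ n
1≤p⇒1≤p^n 1≤p zero    = ℚP.≤-refl
1≤p⇒1≤p^n {p} 1≤p (suc n) =
  ℚP.≤-trans 1≤p (subst (_≤ p * p ^ n) (ℚP.*-identityʳ p)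
    (ℚP.*-monoˡ-≤-nonNeg p {{1≤p⇒nonNeg 1≤p}} (1≤p⇒1≤p^n 1≤p n)))

p*⟦1+m⟧≤⟦1+n⟧⇒p*⟦m⟧≤⟦n⟧ : ∀ {p} m n → 1ℚ ≤ p → p * ⟦ suc m ⟧ ≤ ⟦ suc n ⟧ → p * ⟦ m ⟧ ≤ ⟦ n ⟧
p*⟦1+m⟧≤⟦1+n⟧⇒p*⟦m⟧≤⟦n⟧ {p} m n 1≤p p*⟦1+m⟧≤⟦1+n⟧ = 1+-cancel-≤ (begin
  1ℚ ℚ.+ p * ⟦ m ⟧      ≤⟨ ℚP.+-monoˡ-≤ (p * ⟦ m ⟧) 1≤p ⟩
  p ℚ.+ p * ⟦ m ⟧       ≡⟨ cong (ℚ._+ p * ⟦ m ⟧) (ℚP.*-identityʳ p) ⟨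
  p * 1ℚ ℚ.+ p * ⟦ m ⟧  ≡⟨ ℚP.*-distribˡ-+ p 1ℚ ⟦ m ⟧ ⟨
  p * (1ℚ ℚ.+ ⟦ m ⟧)    ≡⟨ cong (p *_) (⟦⟧-homo-+ 1 m) ⟨
  p * ⟦ suc m ⟧         ≤⟨ p*⟦1+m⟧≤⟦1+n⟧ ⟩
  ⟦ suc n ⟧             ≡⟨ ⟦⟧-homo-+ 1 n ⟩
  1ℚ ℚ.+ ⟦ n ⟧          ∎)
  where
  open ℚP.≤-Reasoning
  1+-cancel-≤ : ∀ {x y} → 1ℚ ℚ.+ x ≤ 1ℚ ℚ.+ y → x ≤ y
  1+-cancel-≤ {x} {y} = subst₂ _≤_ (-1+[1+z]≡z x) (-1+[1+z]≡z y) ∘ ℚP.+-monoʳ-≤ (- 1ℚ)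
    where
    -1+[1+z]≡z : ∀ z → - 1ℚ ℚ.+ (1ℚ ℚ.+ z) ≡ z
    -1+[1+z]≡z z = trans (sym (ℚP.+-assoc (- 1ℚ) 1ℚ z))
      (trans (cong (ℚ._+ z) (ℚP.+-inverseˡ 1ℚ)) (ℚP.+-identityˡ z))

k*q≤⟦l*x⟧⇒q≤⟦x⟧ : ∀ {k q} l x → .{{Positive k}} → ⟦ l ⟧ ≤ k → k * q ≤ ⟦ l ℕ.* x ⟧ → q ≤ ⟦ x ⟧
k*q≤⟦l*x⟧⇒q≤⟦x⟧ {k} {q} l x ⟦l⟧≤k k*q≤⟦l*x⟧ = ℚP.*-cancelˡ-≤-pos k (begin
  k * q           ≤⟨ k*q≤⟦l*x⟧ ⟩
  ⟦ l ℕ.* x ⟧     ≡⟨ ⟦⟧-homo-* l x ⟩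
  ⟦ l ⟧ * ⟦ x ⟧   ≤⟨ ℚP.*-monoʳ-≤-nonNeg ⟦ x ⟧ {{⟦⟧-nonNeg x}} ⟦l⟧≤k ⟩
  k * ⟦ x ⟧       ∎)
  where open ℚP.≤-Reasoning

m∸n≡1+m∸[1+n] : ∀ {m n} → n < m → m ∸ n ≡ suc (m ∸ suc n)
m∸n≡1+m∸[1+n] {suc m} {zero}  _         = refl
m∸n≡1+m∸[1+n] {suc m} {suc n} (s≤s n<m) = m∸n≡1+m∸[1+n] n<m

+m-+n≡+[m∸n] : ∀ {m n} → n ℕ.≤ m → ℤ.+ m ℤ.- ℤ.+ n ≡ ℤ.+ (m ∸ n)
+m-+n≡+[m∸n] {m} {n} n≤m = trans (ℤP.m-n≡m⊖n m n) (ℤP.⊖-≥ n≤m)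

B-bound : ℚ → ℕ → ℕ → ℚ
B-bound k t i = k ^ (t ∸ i) * ⟦ 2 ℕ.* t ∸ i ⟧

module _ (G : Graph) (k : ℚ) {t : ℕ} where

  degreeBound≡B-bound₁ : 0 < t → degreeBound G k t ≡ B-bound k t 1
  degreeBound≡B-bound₁ 0<t
    rewrite +m-+n≡+[m∸n] 0<t | +m-+n≡+[m∸n] (≤-trans 0<t (m≤n*m t 2)) = refl

  threshold≡ : ∀ {i} → i < t → threshold G k t i ≡ k ^ (t ∸ suc i) * ⟦ 2 ℕ.* t ∸ i ⟧
  threshold≡ {i} i<t
    rewrite +m-+n≡+[m∸n] (<⇒≤ i<t) | +m-+n≡+[m∸n] (m<n⇒0<n∸m i<t)
          | +m-+n≡+[m∸n] (≤-trans (<⇒≤ i<t) (m≤n*m t 2))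
    = cong (λ e → k ^ e * ⟦ 2 ℕ.* t ∸ i ⟧) (trans (∸-+-assoc t i 1) (cong (t ∸_) (+-comm i 1)))

  B-bound≡k*threshold : ∀ {i} → i < t → B-bound k t i ≡ k * threshold G k t i
  B-bound≡k*threshold {i} i<t = begin
    k ^ (t ∸ i) * ⟦ 2 ℕ.* t ∸ i ⟧               ≡⟨ cong (λ e → k ^ e * ⟦ 2 ℕ.* t ∸ i ⟧) (m∸n≡1+m∸[1+n] i<t) ⟩
    k * k ^ (t ∸ suc i) * ⟦ 2 ℕ.* t ∸ i ⟧       ≡⟨ ℚP.*-assoc k _ _ ⟩
    k * (k ^ (t ∸ suc i) * ⟦ 2 ℕ.* t ∸ i ⟧)     ≡⟨ cong (k *_) (threshold≡ i<t) ⟨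
    k * threshold G k t i                       ∎
    where open ≡-Reasoning

  threshold≤⟦1+y⟧⇒B-bound≤⟦y⟧ : 1ℚ ≤ k → ∀ {i y} → i < t →
    threshold G k t i ≤ ⟦ suc y ⟧ → B-bound k t (suc i) ≤ ⟦ y ⟧
  threshold≤⟦1+y⟧⇒B-bound≤⟦y⟧ 1≤k {i} {y} i<t threshold≤⟦1+y⟧ =
    p*⟦1+m⟧≤⟦1+n⟧⇒p*⟦m⟧≤⟦n⟧ (2 ℕ.* t ∸ suc i) y (1≤p⇒1≤p^n 1≤k (t ∸ suc i))
      (subst (_≤ ⟦ suc y ⟧) threshold≡′ threshold≤⟦1+y⟧)
    where
    threshold≡′ : threshold G k t i ≡ k ^ (t ∸ suc i) * ⟦ suc (2 ℕ.* t ∸ suc i) ⟧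
    threshold≡′ = trans (threshold≡ i<t)
      (cong (λ c → k ^ (t ∸ suc i) * ⟦ c ⟧) (m∸n≡1+m∸[1+n] (≤-trans i<t (m≤n*m t 2))))

B-bound-self : ∀ k t → B-bound k t t ≡ ⟦ t ⟧
B-bound-self k t = begin
  k ^ (t ∸ t) * ⟦ 2 ℕ.* t ∸ t ⟧  ≡⟨ cong₂ (λ e c → k ^ e * ⟦ c ⟧) (n∸n≡0 t) 2t∸t≡t ⟩
  1ℚ * ⟦ t ⟧                     ≡⟨ ℚP.*-identityˡ ⟦ t ⟧ ⟩
  ⟦ t ⟧                          ∎
  where
  open ≡-Reasoning
  2t∸t≡t : 2 ℕ.* t ∸ t ≡ t
  2t∸t≡t = trans (m+n∸m≡n t (t + 0)) (+-identityʳ t)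

∣p∪q∣≤∣p∣+∣q∣ : ∀ {n} (p q : Subset n) → ∣ p ∪ q ∣ ℕ.≤ ∣ p ∣ + ∣ q ∣
∣p∪q∣≤∣p∣+∣q∣ []          []          = z≤n
∣p∪q∣≤∣p∣+∣q∣ (true  ∷ p) (x     ∷ q) =
  s≤s (≤-trans (∣p∪q∣≤∣p∣+∣q∣ p q) (+-monoʳ-≤ ∣ p ∣ (∣p∣≤∣x∷p∣ x q)))
∣p∪q∣≤∣p∣+∣q∣ (false ∷ p) (true  ∷ q) =
  ≤-trans (s≤s (∣p∪q∣≤∣p∣+∣q∣ p q)) (≤-reflexive (sym (+-suc ∣ p ∣ ∣ q ∣)))
∣p∪q∣≤∣p∣+∣q∣ (false ∷ p) (false ∷ q) = ∣p∪q∣≤∣p∣+∣q∣ p q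

x∉p⇒∣⁅x⁆∪p∣≡1+∣p∣ : ∀ {n} (x : Fin n) (p : Subset n) → x ∉ p → ∣ ⁅ x ⁆ ∪ p ∣ ≡ suc ∣ p ∣
x∉p⇒∣⁅x⁆∪p∣≡1+∣p∣ zero    (true  ∷ p) x∉p = ⊥-elim (x∉p here)
x∉p⇒∣⁅x⁆∪p∣≡1+∣p∣ zero    (false ∷ p) _   = cong (suc ∘ ∣_∣) (∪-identityˡ p)
x∉p⇒∣⁅x⁆∪p∣≡1+∣p∣ (suc x) (true  ∷ p) x∉p = cong suc (x∉p⇒∣⁅x⁆∪p∣≡1+∣p∣ x p (x∉p ∘ there))
x∉p⇒∣⁅x⁆∪p∣≡1+∣p∣ (suc x) (false ∷ p) x∉p = x∉p⇒∣⁅x⁆∪p∣≡1+∣p∣ x p (x∉p ∘ there)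

0<∣p∣⇒Nonempty : ∀ {n} (p : Subset n) → 0 < ∣ p ∣ → Nonempty p
0<∣p∣⇒Nonempty (true  ∷ p) _     = zero , here
0<∣p∣⇒Nonempty (false ∷ p) 0<∣p∣ with 0<∣p∣⇒Nonempty p 0<∣p∣
... | x , x∈p = suc x , there x∈p

⊆-ofSize : ∀ {n} m (p : Subset n) → m ℕ.≤ ∣ p ∣ → ∃ λ q → q ⊆ p × ∣ q ∣ ≡ m
⊆-ofSize {n} zero p      _         = ⊥ , ⊥⊆ , ∣⊥∣≡0 n
⊆-ofSize (suc m) []          ()
⊆-ofSize (suc m) (false ∷ p) m<∣p∣     with ⊆-ofSize (suc m) p m<∣p∣
... | q , q⊆p , ∣q∣≡m = false ∷ q , (λ { (there x∈q) → there (q⊆p x∈q) }) , ∣q∣≡m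
⊆-ofSize (suc m) (true ∷ p)  (s≤s m≤∣p∣) with ⊆-ofSize m p m≤∣p∣
... | q , q⊆p , ∣q∣≡m = true ∷ q , (λ { here → here ; (there x∈q) → there (q⊆p x∈q) }) , cong suc ∣q∣≡m

module _ {A : Set} {n : ℕ} (F : A → Subset n) where

  ∣⋃map∣≤sum : ∀ zs → ∣ ⋃ (map F zs) ∣ ℕ.≤ sum (map (∣_∣ ∘ F) zs)
  ∣⋃map∣≤sum []       = ≤-reflexive (∣⊥∣≡0 n)
  ∣⋃map∣≤sum (z ∷ zs) = ≤-trans (∣p∪q∣≤∣p∣+∣q∣ (F z) _) (+-monoʳ-≤ ∣ F z ∣ (∣⋃map∣≤sum zs))

  x∈⋃map⁺ : ∀ {x z zs} → z ∈ₗ zs → x ∈ F z → x ∈ ⋃ (map F zs)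
  x∈⋃map⁺ {zs = _ ∷ zs} (here refl) x∈Fz = p⊆p∪q (⋃ (map F zs)) x∈Fz
  x∈⋃map⁺ {zs = z ∷ _}  (there z∈zs) x∈Fz = q⊆p∪q (F z) _ (x∈⋃map⁺ z∈zs x∈Fz)

sum≤length*max : ∀ {A : Set} (f : A → ℕ) x xs →
  ∃ λ z → z ∈ₗ x ∷ xs × sum (map f (x ∷ xs)) ℕ.≤ length (x ∷ xs) ℕ.* f z
sum≤length*max f x []       = x , here refl , ≤-refl
sum≤length*max f x (y ∷ ys) with sum≤length*max f y ys
... | z , z∈ , Σf≤l*fz with f x ℕ.≤? f z
...   | yes fx≤fz = z , there z∈ , +-mono-≤ fx≤fz Σf≤l*fz
...   | no  fx≰fz = x , here refl ,
          +-monoʳ-≤ (f x) (≤-trans Σf≤l*fz (*-monoʳ-≤ (length (y ∷ ys)) (<⇒≤ (≰⇒> fx≰fz))))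

∣W∣≤sum[∣Fz∩W∣] : ∀ {A : Set} {n} (F : A → Subset n) (zs : List A) (W : Subset n) →
  (∀ {x} → x ∈ W → ∃ λ z → z ∈ₗ zs × x ∈ F z) → ∣ W ∣ ℕ.≤ sum (map (λ z → ∣ F z ∩ W ∣) zs)
∣W∣≤sum[∣Fz∩W∣] F zs W covered = ≤-trans (p⊆q⇒∣p∣≤∣q∣ W⊆⋃) (∣⋃map∣≤sum (λ z → F z ∩ W) zs)
  where
  W⊆⋃ : W ⊆ ⋃ (map (λ z → F z ∩ W) zs)
  W⊆⋃ x∈W with covered x∈W
  ... | z , z∈zs , x∈Fz = x∈⋃map⁺ (λ z → F z ∩ W) z∈zs (x∈p∩q⁺ (x∈Fz , x∈W))

covering-pigeonhole : ∀ {A : Set} {n} (F : A → Subset n) (zs : List A) (W : Subset n) →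
  (∀ {x} → x ∈ W → ∃ λ z → z ∈ₗ zs × x ∈ F z) → Nonempty W →
  ∃ λ z → z ∈ₗ zs × ∣ W ∣ ℕ.≤ length zs ℕ.* ∣ F z ∩ W ∣
covering-pigeonhole F [] W covered (x , x∈W) with covered x∈W
... | _ , () , _
covering-pigeonhole F (z ∷ zs) W covered _ with sum≤length*max (λ z → ∣ F z ∩ W ∣) z zs
... | y , y∈ , Σ≤l*max = y , y∈ , ≤-trans (∣W∣≤sum[∣Fz∩W∣] F (z ∷ zs) W covered) Σ≤l*max

members : ∀ {n} → Subset n → List (Fin n)
members []          = []
members (true  ∷ p) = zero ∷ map suc (members p)
members (false ∷ p) = map suc (members p)

length-members : ∀ {n} (p : Subset n) → length (members p) ≡ ∣ p ∣
length-members []          = refl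
length-members (true  ∷ p) = cong suc (trans (List.length-map suc (members p)) (length-members p))
length-members (false ∷ p) = trans (List.length-map suc (members p)) (length-members p)

∈members⁺ : ∀ {n} {x : Fin n} (p : Subset n) → x ∈ p → x ∈ₗ members p
∈members⁺ (true  ∷ p) here        = here refl
∈members⁺ (true  ∷ p) (there x∈p) = there (∈-map⁺ suc (∈members⁺ p x∈p))
∈members⁺ (false ∷ p) (there x∈p) = ∈-map⁺ suc (∈members⁺ p x∈p)

∈members⁻ : ∀ {n} {x : Fin n} (p : Subset n) → x ∈ₗ members p → x ∈ p
∈members⁻ (true  ∷ p) (here refl) = here
∈members⁻ (true  ∷ p) (there x∈)  with ∈-map⁻ suc x∈
... | _ , y∈ , refl = there (∈members⁻ p y∈)
∈members⁻ (false ∷ p) x∈          with ∈-map⁻ suc x∈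
... | _ , y∈ , refl = there (∈members⁻ p y∈)

∈⋃map⁅⁆⁻ : ∀ {n} {x : Fin n} xs → x ∈ ⋃ (map ⁅_⁆ xs) → x ∈ₗ xs
∈⋃map⁅⁆⁻ []       x∈ = ⊥-elim (∉⊥ x∈)
∈⋃map⁅⁆⁻ (y ∷ ys) x∈ with x∈p∪q⁻ ⁅ y ⁆ (⋃ (map ⁅_⁆ ys)) x∈
... | inj₁ x∈⁅y⁆ = here (x∈⁅y⁆⇒x≡y y x∈⁅y⁆)
... | inj₂ x∈⋃  = there (∈⋃map⁅⁆⁻ ys x∈⋃)

module _ (G : Graph) where
  open Graph G using (n; adj; irrefl)

  ∈N⇒Adj : ∀ {u x} → x ∈ N G u → Adj G u x
  ∈N⇒Adj {u} {x} x∈Nu = trans (sym (Vec.lookup∘tabulate (adj u) x)) (Vec.[]=⇒lookup x∈Nu)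

  Adj⇒≢ : ∀ {a b} → Adj G a b → a ≢ b
  Adj⇒≢ {a} a~b refl with trans (sym (irrefl a)) a~b
  ... | ()

  ∣N[w]∩X∣≤1+∣Nw∩X∣ : ∀ w X → ∣ N[_] G w ∩ X ∣ ℕ.≤ suc ∣ N G w ∩ X ∣
  ∣N[w]∩X∣≤1+∣Nw∩X∣ w X = begin
    ∣ N[_] G w ∩ X ∣            ≤⟨ p⊆q⇒∣p∣≤∣q∣ N[w]∩X⊆⁅w⁆∪[Nw∩X] ⟩
    ∣ ⁅ w ⁆ ∪ (N G w ∩ X) ∣     ≤⟨ ∣p∪q∣≤∣p∣+∣q∣ ⁅ w ⁆ (N G w ∩ X) ⟩
    ∣ ⁅ w ⁆ ∣ + ∣ N G w ∩ X ∣   ≡⟨ cong (_+ ∣ N G w ∩ X ∣) (∣⁅x⁆∣≡1 w) ⟩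
    suc ∣ N G w ∩ X ∣           ∎
    where
    open ≤-Reasoning
    N[w]∩X⊆⁅w⁆∪[Nw∩X] : N[_] G w ∩ X ⊆ ⁅ w ⁆ ∪ (N G w ∩ X)
    N[w]∩X⊆⁅w⁆∪[Nw∩X] x∈ with x∈p∩q⁻ (N[_] G w) X x∈
    ... | x∈N[w] , x∈X with x∈p∪q⁻ ⁅ w ⁆ (N G w) x∈N[w]
    ...   | inj₁ x≡w  = x∈p∪q⁺ (inj₁ x≡w)
    ...   | inj₂ x∈Nw = x∈p∪q⁺ (inj₂ (x∈p∩q⁺ (x∈Nw , x∈X)))

  Dominates⇒covers : ∀ {Z W} → Dominates G Z W →
    ∀ {x} → x ∈ W → ∃ λ z → z ∈ₗ members Z × x ∈ N[_] G z
  Dominates⇒covers {Z} dominates x∈W with dominates _ x∈W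
  ... | z , z∈Z , x∈N[z] = z , ∈members⁺ Z z∈Z , x∈N[z]

  K₀₀ : HasKtt G 0
  K₀₀ = ⊥ , ⊥ , ∣⊥∣≡0 n , ∣⊥∣≡0 n , (λ _ x∈⊥ _ → ∉⊥ x∈⊥) , (λ _ _ x∈⊥ _ → ⊥-elim (∉⊥ x∈⊥))

  Adj⇒K₁₁ : ∀ {a b} → Adj G a b → HasKtt G 1
  Adj⇒K₁₁ {a} {b} a~b = ⁅ a ⁆ , ⁅ b ⁆ , ∣⁅x⁆∣≡1 a , ∣⁅x⁆∣≡1 b , ⁅a⁆∩⁅b⁆=∅ , ⁅a⁆×⁅b⁆⊆Adj
    where
    ⁅a⁆∩⁅b⁆=∅ : ∀ x → x ∈ ⁅ a ⁆ → x ∉ ⁅ b ⁆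
    ⁅a⁆∩⁅b⁆=∅ x x∈⁅a⁆ x∈⁅b⁆ = Adj⇒≢ a~b (trans (sym (x∈⁅y⁆⇒x≡y a x∈⁅a⁆)) (x∈⁅y⁆⇒x≡y b x∈⁅b⁆))
    ⁅a⁆×⁅b⁆⊆Adj : ∀ x y → x ∈ ⁅ a ⁆ → y ∈ ⁅ b ⁆ → Adj G x y
    ⁅a⁆×⁅b⁆⊆Adj x y x∈⁅a⁆ y∈⁅b⁆ rewrite x∈⁅y⁆⇒x≡y a x∈⁅a⁆ | x∈⁅y⁆⇒x≡y b y∈⁅b⁆ = a~b

  K₁₁⇒Adj : HasKtt G 1 → ∃₂ λ a b → Adj G a b
  K₁₁⇒Adj (A , B , ∣A∣≡1 , ∣B∣≡1 , _ , complete)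
    with 0<∣p∣⇒Nonempty A (≤-reflexive (sym ∣A∣≡1)) | 0<∣p∣⇒Nonempty B (≤-reflexive (sym ∣B∣≡1))
  ... | a , a∈A | b , b∈B = a , b , complete a b a∈A b∈B

  linked-⁅⁆ : ∀ {a b} → Adj G a b → linked G ⁅ a ⁆ ⁅ b ⁆ ≡ true
  linked-⁅⁆ {a} {b} a~b = to T-≡ (any⁺ _ (lose (∈-allFin a) (from T-∧ (x∈⁅x⁆ᵀ a ,
                            any⁺ _ (lose (∈-allFin b) (from T-∧ (x∈⁅x⁆ᵀ b , from T-≡ a~b)))))))
    where
    x∈⁅x⁆ᵀ : ∀ x → T (lookup ⁅ x ⁆ x)
    x∈⁅x⁆ᵀ x = from T-≡ (Vec.[]=⇒lookup (x∈⁅x⁆ x))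

  Adj⇒½≤∇₁ : ∀ {r a b} → IsNabla1 G r → Adj G a b → ℤ.+ 1 ℚ./ 2 ≤ r
  Adj⇒½≤∇₁ {r} {a} {b} (densities≤r , _) a~b = subst (λ m → ℤ.+ m ℚ./ 2 ≤ r) edges≡1 (densities≤r 1 edge)
    where
    edge : ShallowMinor G 2
    edge = record
      { branch   = λ { zero → ⁅ a ⁆ ; (suc zero) → ⁅ b ⁆ }
      ; centre   = λ { zero → a ; (suc zero) → b }
      ; centre∈  = λ { zero → x∈⁅x⁆ a ; (suc zero) → x∈⁅x⁆ b }
      ; radius1  = λ { zero _ x∈ → p⊆p∪q (N G a) x∈ ; (suc zero) _ x∈ → p⊆p∪q (N G b) x∈ }
      ; disjoint = λ
          { zero       zero       _ i≢j _  _  → i≢j refl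
          ; zero       (suc zero) x _   x∈ x∈′ → Adj⇒≢ a~b (trans (sym (x∈⁅y⁆⇒x≡y a x∈)) (x∈⁅y⁆⇒x≡y b x∈′))
          ; (suc zero) zero       x _   x∈ x∈′ → Adj⇒≢ a~b (trans (sym (x∈⁅y⁆⇒x≡y a x∈′)) (x∈⁅y⁆⇒x≡y b x∈))
          ; (suc zero) (suc zero) _ i≢j _  _  → i≢j refl
          }
      }
    -- the sum defining edges has the single nonzero term at (i, j) = (0, 1)
    edges≡1 : edges edge ≡ 1
    edges≡1 = cong (λ l → ((if l then 1 else 0) + 0) + 0) (linked-⁅⁆ a~b)

  2≤t : ∀ {k t v} → IsLeastNoKtt G t → degreeBound G k t ≤ ⟦ ∣ N G v ∣ ⟧ → 2 ℕ.≤ t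
  2≤t {t = zero}        (noKtt , _) _   = ⊥-elim (noKtt K₀₀)
  -- for t = 1 the degree bound k⁰ (2 - 1) computes to ⟦ 1 ⟧
  2≤t {t = suc zero} {v} (noKtt , _) deg with 0<∣p∣⇒Nonempty (N G v) (⟦⟧-cancel-≤ deg)
  ... | _ , w∈Nv = ⊥-elim (noKtt (Adj⇒K₁₁ (∈N⇒Adj w∈Nv)))
  2≤t {t = suc (suc _)} _           _   = s≤s (s≤s z≤n)

  1≤2∇₁ : ∀ {r t} → IsNabla1 G r → IsLeastNoKtt G t → 2 ℕ.≤ t → 1ℚ ≤ ⟦ 2 ⟧ * r
  1≤2∇₁ {r} ∇₁≡r (_ , Ktt-below) 2≤t =
    subst (_≤ ⟦ 2 ⟧ * r) ⟦2⟧*½≡1 (ℚP.*-monoˡ-≤-nonNeg ⟦ 2 ⟧ {{⟦⟧-nonNeg 2}} ½≤r)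
    where
    ½≤r : ℤ.+ 1 ℚ./ 2 ≤ r
    ½≤r = let _ , _ , a~b = K₁₁⇒Adj (Ktt-below 1 2≤t) in Adj⇒½≤∇₁ ∇₁≡r a~b
    ⟦2⟧*½≡1 : ⟦ 2 ⟧ * (ℤ.+ 1 ℚ./ 2) ≡ 1ℚ
    ⟦2⟧*½≡1 = refl

module _ (G : Graph) {k : ℚ} {t : ℕ} {v : V G} where

  B-step : ∀ {us w} → ValidSeq G k t v us → B G (w ∷ us) ≡ N G w ∩ B G us
  B-step start      = refl
  B-step (step _ _) = refl

  B⊆N : ∀ {vs u} → ValidSeq G k t v vs → u ∈ₗ vs → B G vs ⊆ N G u
  B⊆N start                   (here refl)  = λ x∈ → x∈
  B⊆N (step {us} {w} valid _) (here refl)  =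
    subst (_⊆ N G w) (sym (B-step valid)) (p∩q⊆p (N G w) (B G us))
  B⊆N (step {us} {w} valid _) (there u∈us) =
    subst (_⊆ N G _) (sym (B-step valid)) (B⊆N valid u∈us ∘ p∩q⊆q (N G w) (B G us))

  v∈ : ∀ {vs} → ValidSeq G k t v vs → v ∈ₗ vs
  v∈ start          = here refl
  v∈ (step valid _) = there (v∈ valid)

  ∣⋃map⁅⁆∣≡length : ∀ {vs} → ValidSeq G k t v vs → ∣ ⋃ (map ⁅_⁆ vs) ∣ ≡ length vs
  ∣⋃map⁅⁆∣≡length start = trans (x∉p⇒∣⁅x⁆∪p∣≡1+∣p∣ v ⊥ ∉⊥) (cong suc (∣⊥∣≡0 (Graph.n G)))
  ∣⋃map⁅⁆∣≡length (step {us} {w} valid (w∉us , _)) =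
    trans (x∉p⇒∣⁅x⁆∪p∣≡1+∣p∣ w _ (w∉us ∘ ∈⋃map⁅⁆⁻ us)) (cong suc (∣⋃map⁅⁆∣≡length valid))

module _ (G : Graph) {k : ℚ} {t : ℕ} {v : V G}
         (1≤k : 1ℚ ≤ k) (0<t : 0 < t) (deg : degreeBound G k t ≤ ⟦ ∣ N G v ∣ ⟧) where

  B-bound≤∣B∣ : ∀ {vs} → ValidSeq G k t v vs → length vs ℕ.≤ t → B-bound k t (length vs) ≤ ⟦ ∣ B G vs ∣ ⟧
  B-bound≤∣B∣ start _ = subst (_≤ ⟦ ∣ N G v ∣ ⟧) (degreeBound≡B-bound₁ G k 0<t) deg
  B-bound≤∣B∣ (step {us} {w} valid (_ , threshold≤)) i<t =
    subst (λ X → B-bound k t (suc (length us)) ≤ ⟦ ∣ X ∣ ⟧) (sym (B-step G valid))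
      (threshold≤⟦1+y⟧⇒B-bound≤⟦y⟧ G k 1≤k {y = ∣ N G w ∩ B G us ∣} i<t
        (ℚP.≤-trans threshold≤ (⟦⟧-mono-≤ (∣N[w]∩X∣≤1+∣Nw∩X∣ G w (B G us)))))

  B-nonempty : ∀ {vs} → ValidSeq G k t v vs → length vs < t → Nonempty (B G vs)
  B-nonempty {vs} valid s<t = 0<∣p∣⇒Nonempty (B G vs) (≤-trans 0<2t∸s (⟦⟧-cancel-≤ ⟦2t∸s⟧≤∣B∣))
    where
    2t∸s = 2 ℕ.* t ∸ length vs
    0<2t∸s : 0 < 2t∸s
    0<2t∸s = m<n⇒0<n∸m (≤-trans s<t (m≤n*m t 2))
    ⟦2t∸s⟧≤∣B∣ : ⟦ 2t∸s ⟧ ≤ ⟦ ∣ B G vs ∣ ⟧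
    ⟦2t∸s⟧≤∣B∣ = ℚP.≤-trans (1≤p⇒q≤p*q (1≤p⇒1≤p^n 1≤k (t ∸ length vs)) ⟦ 2t∸s ⟧ {{⟦⟧-nonNeg 2t∸s}})
                            (B-bound≤∣B∣ valid (<⇒≤ s<t))

  t≤∣B∣ : ∀ {vs} → ValidSeq G k t v vs → length vs ≡ t → t ℕ.≤ ∣ B G vs ∣
  t≤∣B∣ {vs} valid s≡t =
    ⟦⟧-cancel-≤ (subst (_≤ ⟦ ∣ B G vs ∣ ⟧) B-bound≡⟦t⟧ (B-bound≤∣B∣ valid (≤-reflexive s≡t)))
    where
    B-bound≡⟦t⟧ : B-bound k t (length vs) ≡ ⟦ t ⟧
    B-bound≡⟦t⟧ = trans (cong (B-bound k t) s≡t) (B-bound-self k t)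

  length≡t⇒Ktt : ∀ {vs} → ValidSeq G k t v vs → length vs ≡ t → HasKtt G t
  length≡t⇒Ktt {vs} valid s≡t =
    let Y , Y⊆B , ∣Y∣≡t = ⊆-ofSize t (B G vs) (t≤∣B∣ valid s≡t)
        Y⊆N : ∀ {x} → x ∈ X → Y ⊆ N G x
        Y⊆N x∈X = B⊆N G valid (∈⋃map⁅⁆⁻ vs x∈X) ∘ Y⊆B
    in  X , Y , trans (∣⋃map⁅⁆∣≡length G valid) s≡t , ∣Y∣≡t
          , (λ x x∈X x∈Y → Adj⇒≢ G (∈N⇒Adj G (Y⊆N x∈X x∈Y)) refl)
          , (λ x y x∈X y∈Y → ∈N⇒Adj G (Y⊆N x∈X y∈Y))
    where
    X = ⋃ (map ⁅_⁆ vs)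

  length<t : ¬ HasKtt G t → 2 ℕ.≤ t → ∀ {vs} → ValidSeq G k t v vs → length vs < t
  length<t _     2≤t start                  = 2≤t
  length<t noKtt 2≤t (step valid extension) =
    ≤∧≢⇒< (length<t noKtt 2≤t valid) (noKtt ∘ length≡t⇒Ktt (step valid extension))

  extends : ∀ {vs z} l → ValidSeq G k t v vs → length vs < t → ¬ z ∈ₗ vs → ⟦ l ⟧ ≤ k →
    ∣ B G vs ∣ ℕ.≤ l ℕ.* ∣ N[_] G z ∩ B G vs ∣ → CanExtend G k t vs z
  extends {vs} {z} l valid s<t z∉vs ⟦l⟧≤k ∣B∣≤l*∣N[z]∩B∣ =
    z∉vs , k*q≤⟦l*x⟧⇒q≤⟦x⟧ l _ {{1≤p⇒pos 1≤k}} ⟦l⟧≤k (begin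
      k * threshold G k t (length vs)   ≡⟨ B-bound≡k*threshold G k s<t ⟨
      B-bound k t (length vs)           ≤⟨ B-bound≤∣B∣ valid (<⇒≤ s<t) ⟩
      ⟦ ∣ B G vs ∣ ⟧                    ≤⟨ ⟦⟧-mono-≤ ∣B∣≤l*∣N[z]∩B∣ ⟩
      ⟦ l ℕ.* ∣ N[_] G z ∩ B G vs ∣ ⟧   ∎)
    where open ℚP.≤-Reasoning

  avoids-D⇒∈D̂ : ∀ D {vs u} → ValidSeq G k t v vs → Maximal G k t vs → length vs < t →
    ¬ Any (_∈ D) vs → u ∈ₗ vs → _∈D̂[_,_] G u k D
  avoids-D⇒∈D̂ D {vs} valid maximal s<t avoidsD u∈vs (Z , Z⊆D , _ , ∣Z∣≤k , dominates) =
    let z , z∈Z , ∣B∣≤∣Z∣*∣N[z]∩B∣ = covering-pigeonhole (N[_] G) (members Z) (B G vs)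
          (Dominates⇒covers G dominates ∘ B⊆N G valid u∈vs) (B-nonempty valid s<t)
        z∉vs : ¬ z ∈ₗ vs
        z∉vs z∈vs = avoidsD (lose z∈vs (Z⊆D z (∈members⁻ Z z∈Z)))
    in  maximal (z , extends (length (members Z)) valid s<t z∉vs ∣members∣≤k ∣B∣≤∣Z∣*∣N[z]∩B∣)
    where
    ∣members∣≤k : ⟦ length (members Z) ⟧ ≤ k
    ∣members∣≤k = subst (λ m → ⟦ m ⟧ ≤ k) (sym (length-members Z)) ∣Z∣≤k

  meets-D′ : ∀ D {vs} → ValidSeq G k t v vs → Maximal G k t vs → length vs < t →
    Dec (Any (_∈ D) vs) → Any (λ x → _∈D'[_,_] G x k D) vs
  meets-D′ D valid maximal s<t (yes meetsD)  = Any.map inj₁ meetsD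
  meets-D′ D valid maximal s<t (no  avoidsD) =
    lose (v∈ G valid) (inj₂ (avoids-D⇒∈D̂ D valid maximal s<t avoidsD (v∈ G valid)))

lemma6 : (G : Graph) (r k : ℚ) (t : ℕ) (D : Subset (Graph.n G)) →
    IsNabla1 G r → k ≡ ⟦ 2 ⟧ * r →
    StandingAssumption G k →
    IsLeastNoKtt G t →
    IsMinimumDominatingSet G D →
    (v : V G) → degreeBound G k t ≤ ⟦ ∣ N G v ∣ ⟧ →
    (vs : List (V G)) → ValidSeq G k t v vs → Maximal G k t vs →
    length vs < t × Any (λ x → _∈D'[_,_] G x k D) vs
lemma6 G r k t D ∇₁≡r k≡2r _ least _ v deg vs valid maximal =
  s<t , meets-D′ G 1≤k 0<t deg D valid maximal s<t (any? (_∈? D) vs)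
  where
  t≥2 : 2 ℕ.≤ t
  t≥2 = 2≤t G least deg
  0<t : 0 < t
  0<t = <⇒≤ t≥2
  1≤k : 1ℚ ≤ k
  1≤k = subst (1ℚ ≤_) (sym k≡2r) (1≤2∇₁ G ∇₁≡r least t≥2)
  s<t : length vs < t
  s<t = length<t G 1≤k 0<t deg (proj₁ least) t≥2 valid
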